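{- Let $X$ be a finite set with $|X|\geq 3$ and let $M$ be a set. If $\mathcal T=(T,t)$ and $\mathcal T'=(T',t')$ are labelled rooted trees on $X$ such that $\delta_{\mathcal T}=\delta_{\mathcal T'}$ and $T$ and $T'$ display exactly the same set of triplets, then $\mathcal T$ and $\mathcal T'$ are isomorphic. That is, up to isomorphism, a labelled rooted tree $\mathcal T$ is uniquely determined by $\delta_{\mathcal T}$ together with the set of triplets displayed by $\mathcal T$.
   Context: A rooted phylogenetic tree on $X$ is a rooted tree with leaf set $X$ having no vertex of indegree one and outdegree one; a labelled rooted tree is a pair $(T,t)$ with $t$ a map from internal vertices to $M$. $\mathrm{lca}_T(x,y)$ is the last common vertex of the root-to-$x$ and root-to-$y$ paths. $\delta_{\mathcal T}(x,y,z)$ is the multiset $\{t(\mathrm{lca}_T(x,y)),t(\mathrm{lca}_T(x,z)),t(\mathrm{lca}_T(y,z))\}$ for distinct $x,y,z\in X$. $T$ displays the triplet $xy|z$ ($x,y,z$ distinct) if $\mathrm{lca}_T(x,z)=\mathrm{lca}_T(y,z)\neq\mathrm{lca}_T(x,y)$. Two labelled rooted trees are isomorphic if there is a root-preserving graph isomorphism between them that is the identity on $X$ and preserves labels. -}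

module Defs where

open import Level using (Level)
open import Data.Nat using (ℕ; zero; suc; _≥_)
open import Data.Fin using (Fin)
open import Data.Maybe using (Maybe; just; nothing; _>>=_; map)
open import Data.Product using (Σ; ∃; ∃-syntax; _×_; _,_)
open import Data.List using (List; _∷_; [])
open import Data.List.Relation.Binary.Permutation.Propositional using (_↭_)
open import Relation.Binary.PropositionalEquality using (_≡_; _≢_)
open import Relation.Nullary using (¬_)
open import Function.Bundles using (_↔_; _⇔_; Inverse)
open import Function.Definitions using (Injective)

-- Vertices of a tree with n vertices are Fin n; arcs point from a vertex to
-- its children and are encoded by a parent map.  up k v = the vertex reached
-- from v by following k parent arcs (if any).
up : ∀ {n} → (Fin n → Maybe (Fin n)) → ℕ → Fin n → Maybe (Fin n)
up par zero    v = just v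
up par (suc k) v = par v >>= up par k

record LabelledRootedTree (m : ℕ) (M : Set) : Set where
  field
    n       : ℕ
    root    : Fin n
    parent  : Fin n → Maybe (Fin n)
    -- rooted tree: the root is the unique vertex without parent (indegree 0),
    -- every other vertex has exactly one parent, and every vertex reaches
    -- the root (so there are no cycles)
    root-noParent : parent root ≡ nothing
    noParent⇒root : ∀ v → parent v ≡ nothing → v ≡ root
    reachRoot     : ∀ v → ∃[ k ] up parent k v ≡ just root
    leaf       : Fin m → Fin n
    leaf-inj   : Injective _≡_ _≡_ leaf
    leaf-exact : ∀ v → (¬ (∃[ w ] parent w ≡ just v)) ⇔ (∃[ x ] leaf x ≡ v)
    branching  : ∀ v → (∃[ w ] parent w ≡ just v) →
                 ∃[ w₁ ] ∃[ w₂ ] (w₁ ≢ w₂ × parent w₁ ≡ just v × parent w₂ ≡ just v)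
    -- labelling of vertices; only values at internal vertices are relevant
    label      : Fin n → M

module _ {m : ℕ} {M : Set} (T : LabelledRootedTree m M) where
  open LabelledRootedTree T

  Internal : Fin n → Set
  Internal v = ∃[ w ] parent w ≡ just v

  _≼_ : Fin n → Fin n → Set
  u ≼ v = ∃[ k ] up parent k v ≡ just u

  IsLCA : Fin n → Fin m → Fin m → Set
  IsLCA u x y = u ≼ leaf x × u ≼ leaf y ×
                (∀ w → w ≼ leaf x → w ≼ leaf y → w ≼ u)

  Displays : Fin m → Fin m → Fin m → Set
  Displays x y z = ∃[ a ] ∃[ b ] ∃[ c ]
    (IsLCA a x z × IsLCA b y z × IsLCA c x y × a ≡ b × a ≢ c)

Distinct3 : ∀ {m} → Fin m → Fin m → Fin m → Set
Distinct3 x y z = x ≢ y × x ≢ z × y ≢ z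

-- δ_T = δ_T' : for distinct x,y,z the multisets
-- {t(lca(x,y)), t(lca(x,z)), t(lca(y,z))} coincide (multiset equality = permutation)
SameDelta : ∀ {m M} → LabelledRootedTree m M → LabelledRootedTree m M → Set
SameDelta {m} T T' = ∀ (x y z : Fin m) → Distinct3 x y z →
  ∀ a b c a' b' c' →
  IsLCA T a x y → IsLCA T b x z → IsLCA T c y z →
  IsLCA T' a' x y → IsLCA T' b' x z → IsLCA T' c' y z →
  (LabelledRootedTree.label T a ∷ LabelledRootedTree.label T b ∷ LabelledRootedTree.label T c ∷ [])
  ↭ (LabelledRootedTree.label T' a' ∷ LabelledRootedTree.label T' b' ∷ LabelledRootedTree.label T' c' ∷ [])

SameTriplets : ∀ {m M} → LabelledRootedTree m M → LabelledRootedTree m M → Set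
SameTriplets {m} T T' = ∀ (x y z : Fin m) → Distinct3 x y z →
  Displays T x y z ⇔ Displays T' x y z

Isomorphic : ∀ {m M} → LabelledRootedTree m M → LabelledRootedTree m M → Set
Isomorphic {m} T T' =
  Σ (Fin (LabelledRootedTree.n T) ↔ Fin (LabelledRootedTree.n T')) λ φ →
    let f = Inverse.to φ in
    (f (LabelledRootedTree.root T) ≡ LabelledRootedTree.root T') ×
    (∀ v → LabelledRootedTree.parent T' (f v) ≡ map f (LabelledRootedTree.parent T v)) ×
    (∀ x → LabelledRootedTree.leaf T' x ≡ f (LabelledRootedTree.leaf T x)) ×
    (∀ v → Internal T v → LabelledRootedTree.label T' (f v) ≡ LabelledRootedTree.label T v)

-- A vertex of a phylogenetic tree is determined by its cluster, the set of leaves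
-- below it, and u is an ancestor of v iff the cluster of v is contained in that of u.
-- The cluster of lca(x, y) consists of x, y and the leaves z for which xy|z is not
-- displayed, so two trees displaying the same triplets have the same clusters, and
-- matching vertices with equal clusters is an isomorphism of the underlying rooted
-- trees.  For an internal vertex v = lca(x, y) and a third leaf z, two of
-- lca(x, y), lca(x, z), lca(y, z) coincide, in the same way in both trees, and this
-- pattern tells where t(v) sits in the multiset δ(x, y, z).

module Submission where

open import Defs
open import Data.Nat using (ℕ; zero; suc; _+_; _∸_; _≤_; _<_; _≥_; s≤s)
open import Data.Nat.Properties
  using (+-comm; +-suc; ≤-total; ≤-antisym; ≤-pred; <-irrefl; m+[n∸m]≡n; m∸n≡0⇒m≤n)
open import Data.Fin using (Fin; toℕ; fromℕ<) renaming (zero to fzero; suc to fsuc)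
open import Data.Fin.Properties using (_≟_; any?; toℕ-injective; toℕ-fromℕ<; toℕ<n; injective⇒≤)
open import Data.Maybe using (Maybe; just; nothing; _>>=_; map)
open import Data.Maybe.Properties using (just-injective; ≡-dec)
open import Data.List using (_∷_; [])
open import Data.List.Relation.Binary.Permutation.Propositional using (_↭_; ↭-refl; ↭-sym; ↭-trans; swap)
open import Data.List.Relation.Binary.Permutation.Propositional.Properties
  using (∈-resp-↭; drop-mid; shift)
open import Data.List.Relation.Unary.Any using (here; there)
open import Data.Product using (∃-syntax; _×_; _,_; proj₁; proj₂)
open import Data.Sum using (_⊎_; inj₁; inj₂)
import Data.Sum as Sum
open import Data.Empty using (⊥-elim)
open import Function using (_∘_)
open import Function.Bundles using (_⇔_; mk⇔; Equivalence; _↔_; mk↔ₛ′)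
open import Function.Properties.Equivalence using () renaming (sym to ⇔-sym; trans to ⇔-trans)
open import Function.Related.TypeIsomorphisms using (¬-cong-⇔)
open import Relation.Binary.PropositionalEquality
open import Relation.Nullary using (¬_; Dec; yes; no; contradiction)
open import Relation.Nullary.Decidable using (map′)

open Equivalence using (to; from)

module _ {A : Set} where

  ↭-pair-inv : ∀ {a b c d : A} → (a ∷ b ∷ []) ↭ (c ∷ d ∷ []) →
    (a ≡ c × b ≡ d) ⊎ (a ≡ d × b ≡ c)
  ↭-pair-inv p with ∈-resp-↭ p (here refl)
  ... | here refl with ∈-resp-↭ (drop-mid [] [] p) (here refl)
  ...   | here refl = inj₁ (refl , refl)
  ↭-pair-inv p | there (here refl) with ∈-resp-↭ (drop-mid [] (_ ∷ []) p) (here refl)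
  ...   | here refl = inj₂ (refl , refl)

  ↭-twin-pair-inv : ∀ {b c d : A} → (b ∷ b ∷ []) ↭ (c ∷ d ∷ []) → b ≡ c × b ≡ d
  ↭-twin-pair-inv p with ↭-pair-inv p
  ... | inj₁ (e , e') = e , e'
  ... | inj₂ (e , e') = e' , e

  ↭-single-twin-inv : ∀ {a b a' b' : A} →
    (a ∷ b ∷ b ∷ []) ↭ (a' ∷ b' ∷ b' ∷ []) → a ≡ a' × b ≡ b'
  ↭-single-twin-inv p with ∈-resp-↭ p (here refl)
  ... | here refl = refl , proj₁ (↭-twin-pair-inv (drop-mid [] [] p))
  ... | there (here refl) with ↭-twin-pair-inv (drop-mid [] (_ ∷ []) p)
  ...   | refl , refl = refl , refl
  ↭-single-twin-inv p | there (there (here refl)) with ↭-twin-pair-inv (drop-mid [] (_ ∷ _ ∷ []) p)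
  ...   | refl , refl = refl , refl

  ↭-head-inv : ∀ {a b c a' b' c' : A} →
    (b ≡ c × b' ≡ c') ⊎ (a ≡ b × a' ≡ b') ⊎ (a ≡ c × a' ≡ c') →
    (a ∷ b ∷ c ∷ []) ↭ (a' ∷ b' ∷ c' ∷ []) → a ≡ a'
  ↭-head-inv (inj₁ (refl , refl)) p = proj₁ (↭-single-twin-inv p)
  ↭-head-inv (inj₂ (inj₁ (refl , refl))) p =
    proj₂ (↭-single-twin-inv (↭-trans (↭-sym (shift _ (_ ∷ _ ∷ []) []))
                                      (↭-trans p (shift _ (_ ∷ _ ∷ []) []))))
  ↭-head-inv (inj₂ (inj₂ (refl , refl))) p =
    proj₂ (↭-single-twin-inv (↭-trans (swap _ _ ↭-refl) (↭-trans p (swap _ _ ↭-refl))))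

module RootedTree {m : ℕ} {M : Set} (T : LabelledRootedTree m M) where
  open LabelledRootedTree T public

  infix 4 _⊑_
  _⊑_ : Fin n → Fin n → Set
  _⊑_ = _≼_ T

  up-+ : ∀ i j v → up parent (i + j) v ≡ (up parent i v >>= up parent j)
  up-+ zero    j v = refl
  up-+ (suc i) j v with parent v
  ... | nothing = refl
  ... | just w  = up-+ i j w

  up-+-just : ∀ i j {v w} → up parent i v ≡ just w → up parent (i + j) v ≡ up parent j w
  up-+-just i j {v} e rewrite up-+ i j v | e = refl

  up-split : ∀ {k j v a} → k ≤ j → up parent k v ≡ just a → up parent (j ∸ k) a ≡ up parent j v
  up-split {k} {j} {v} k≤j e =
    trans (sym (up-+-just k (j ∸ k) e)) (cong (λ i → up parent i v) (m+[n∸m]≡n k≤j))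

  up-suc-inv : ∀ k {v u} → up parent (suc k) v ≡ just u →
    ∃[ w ] (parent v ≡ just w × up parent k w ≡ just u)
  up-suc-inv k {v} e with parent v
  ... | just w = w , refl , e

  up-suc-last : ∀ k {w u} → up parent (suc k) w ≡ just u →
    ∃[ c ] (up parent k w ≡ just c × parent c ≡ just u)
  up-suc-last zero {w} e with parent w in pw
  up-suc-last zero {w} refl | just p = w , refl , pw
  up-suc-last (suc k) {w} e with parent w
  ... | just p = up-suc-last k e

  up-suc-root : ∀ k → up parent (suc k) root ≡ nothing
  up-suc-root k rewrite root-noParent = refl

  up-bound : ∀ {K k v u} → up parent K v ≡ just root → up parent k v ≡ just u → k ≤ K
  up-bound {K} {k} r e with ≤-total k K
  ... | inj₁ k≤K = k≤K
  ... | inj₂ K≤k with k ∸ K in d≡ | up-split K≤k r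
  ...   | zero  | _ = m∸n≡0⇒m≤n d≡
  ...   | suc d | s with trans (sym (up-suc-root d)) (trans s e)
  ...     | ()

  on-cycle-parent : ∀ {k w} → up parent (suc k) w ≡ just w →
    ∃[ p ] (parent w ≡ just p × up parent (suc k) p ≡ just p)
  on-cycle-parent {k} e with up-suc-inv k e
  ... | p , pw , e' = p , pw , subst (λ i → up parent i p ≡ just p) (+-comm k 1)
                                      (trans (up-+-just k 1 e') (cong (_>>= just) pw))

  on-cycle-up : ∀ {k w} → up parent (suc k) w ≡ just w → ∀ i → ∃[ u ] (up parent i w ≡ just u)
  on-cycle-up {w = w} e zero = w , refl
  on-cycle-up {k} e (suc i) with on-cycle-parent {k} e
  ... | p , pw , e' with on-cycle-up {k} e' i
  ...   | u , eu = u , trans (cong (_>>= up parent i) pw) eu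

  -- from a vertex on a cycle one can climb arbitrarily high, but not past the root
  acyclic : ∀ {k v} → ¬ (up parent (suc k) v ≡ just v)
  acyclic {k} {v} e with reachRoot v
  ... | K , r = <-irrefl refl (up-bound {K} {suc K} r (proj₂ (on-cycle-up {k} e (suc K))))

  ⊑-refl : ∀ {v} → v ⊑ v
  ⊑-refl = 0 , refl

  ⊑-trans : ∀ {u v w} → u ⊑ v → v ⊑ w → u ⊑ w
  ⊑-trans (k , e) (j , e') = j + k , trans (up-+-just j k e') e

  ⊑-antisym : ∀ {u v} → u ⊑ v → v ⊑ u → u ≡ v
  ⊑-antisym (zero , e) _ = sym (just-injective e)
  ⊑-antisym {u} (suc k , e) (j , e') =
    ⊥-elim (acyclic {j + k} (subst (λ i → up parent i u ≡ just u) (+-suc j k)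
                                   (trans (up-+-just j (suc k) e') e)))

  ⊑-total-below : ∀ {u v w} → u ⊑ w → v ⊑ w → u ⊑ v ⊎ v ⊑ u
  ⊑-total-below (k , e) (j , e') with ≤-total k j
  ... | inj₁ k≤j = inj₂ (j ∸ k , trans (up-split k≤j e) e')
  ... | inj₂ j≤k = inj₁ (k ∸ j , trans (up-split j≤k e') e)

  root-⊑ : ∀ v → root ⊑ v
  root-⊑ = reachRoot

  parent-⊑ : ∀ {c p} → parent c ≡ just p → p ⊑ c
  parent-⊑ pc = 1 , cong (_>>= just) pc

  no-self-parent : ∀ {v} → ¬ (parent v ≡ just v)
  no-self-parent {v} pv = acyclic {0} {v} (cong (_>>= just) pv)

  ⊑-parent-cases : ∀ {w c p} → w ⊑ c → parent c ≡ just p → w ≡ c ⊎ w ⊑ p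
  ⊑-parent-cases (zero , e) _ = inj₁ (sym (just-injective e))
  ⊑-parent-cases {w} (suc k , e) pc with up-suc-inv k e
  ... | q , qc , e' =
    inj₂ (k , subst (λ x → up parent k x ≡ just w) (just-injective (trans (sym qc) pc)) e')

  ⊑-child-cases : ∀ {v u} → v ⊑ u → v ≡ u ⊎ ∃[ c ] (parent c ≡ just v × c ⊑ u)
  ⊑-child-cases (zero , e) = inj₁ (sym (just-injective e))
  ⊑-child-cases (suc k , e) with up-suc-last k e
  ... | c , ec , pc = inj₂ (c , pc , k , ec)

  _⊑?_ : ∀ u v → Dec (u ⊑ v)
  u ⊑? v with reachRoot v
  ... | K , r = map′ (λ (i , e) → toℕ i , e) within-depth
                     (any? λ i → ≡-dec _≟_ (up parent (toℕ i) v) (just u))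
    where
    within-depth : u ⊑ v → ∃[ i ] (up parent (toℕ {suc K} i) v ≡ just u)
    within-depth (k , e) = fromℕ< k<1+K , subst (λ j → up parent j v ≡ just u) (sym (toℕ-fromℕ< k<1+K)) e
      where
      k<1+K : k < suc K
      k<1+K = s≤s (up-bound {K} {k} r e)

  internal? : ∀ v → Dec (Internal T v)
  internal? v = any? λ w → ≡-dec _≟_ (parent w) (just v)

  leaf-not-internal : ∀ x → ¬ Internal T (leaf x)
  leaf-not-internal x = from (leaf-exact (leaf x)) (x , refl)

  leaf-⊑-leaf : ∀ {x y} → leaf x ⊑ leaf y → x ≡ y
  leaf-⊑-leaf x⊑y with ⊑-child-cases x⊑y
  ... | inj₁ e = leaf-inj e
  ... | inj₂ (c , pc , _) = ⊥-elim (leaf-not-internal _ (c , pc))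

  siblings-⊑ : ∀ {d d' p} → parent d ≡ just p → parent d' ≡ just p → d ⊑ d' → d ≡ d'
  siblings-⊑ {d} pd pd' d⊑d' with ⊑-parent-cases d⊑d' pd'
  ... | inj₁ e = e
  ... | inj₂ d⊑p =
    ⊥-elim (no-self-parent (subst (λ x → parent d ≡ just x) (⊑-antisym (parent-⊑ pd) d⊑p) pd))

  siblings-below : ∀ {d d' p w} → parent d ≡ just p → parent d' ≡ just p → d ⊑ w → d' ⊑ w → d ≡ d'
  siblings-below pd pd' d⊑w d'⊑w with ⊑-total-below d⊑w d'⊑w
  ... | inj₁ d⊑d' = siblings-⊑ pd pd' d⊑d'
  ... | inj₂ d'⊑d = sym (siblings-⊑ pd' pd d'⊑d)

  another-child : ∀ {v c} → parent c ≡ just v → ∃[ d ] (parent d ≡ just v × d ≢ c)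
  another-child {v} {c} pc with branching v (c , pc)
  ... | w₁ , w₂ , w₁≢w₂ , p₁ , p₂ with w₁ ≟ c
  ...   | yes refl = w₂ , p₂ , w₁≢w₂ ∘ sym
  ...   | no w₁≢c  = w₁ , p₁ , w₁≢c

  up-prefix : ∀ {i k w u} → i ≤ k → up parent k w ≡ just u → ∃[ a ] (up parent i w ≡ just a)
  up-prefix {i} {k} {w} i≤k e =
    bind-just (trans (sym (up-+ i (k ∸ i) w)) (trans (cong (λ j → up parent j w) (m+[n∸m]≡n i≤k)) e))
    where
    bind-just : ∀ {mx : Maybe (Fin n)} {f u} → (mx >>= f) ≡ just u → ∃[ a ] (mx ≡ just a)
    bind-just {just a} _ = a , refl

  up-injective-≤ : ∀ {k j v u} → k ≤ j → up parent k v ≡ just u → up parent j v ≡ just u → k ≡ j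
  up-injective-≤ {k} {j} k≤j e₁ e₂ with j ∸ k in d≡ | up-split k≤j e₁
  ... | zero  | _ = ≤-antisym k≤j (m∸n≡0⇒m≤n d≡)
  ... | suc d | s = ⊥-elim (acyclic {d} (trans s e₂))

  up-injective : ∀ {k j v u} → up parent k v ≡ just u → up parent j v ≡ just u → k ≡ j
  up-injective {k} {j} e₁ e₂ with ≤-total k j
  ... | inj₁ k≤j = up-injective-≤ k≤j e₁ e₂
  ... | inj₂ j≤k = sym (up-injective-≤ j≤k e₂ e₁)

  up-length-bound : ∀ {k w u} → up parent k w ≡ just u → k < n
  up-length-bound {k} {w} e = injective⇒≤ {f = proj₁ ∘ path} path-injective
    where
    path : (i : Fin (suc k)) → ∃[ a ] (up parent (toℕ i) w ≡ just a)
    path i = up-prefix (≤-pred (toℕ<n i)) e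
    path-injective : ∀ {i j} → proj₁ (path i) ≡ proj₁ (path j) → i ≡ j
    path-injective {i} {j} eq = toℕ-injective
      (up-injective (proj₂ (path i)) (subst (λ a → up parent (toℕ j) w ≡ just a) (sym eq)
                                            (proj₂ (path j))))

  descend : ∀ i v → (∃[ x ] (v ⊑ leaf x)) ⊎ (∃[ w ] (up parent i w ≡ just v))
  descend zero v = inj₂ (v , refl)
  descend (suc i) v with descend i v
  ... | inj₁ found = inj₁ found
  ... | inj₂ (w , e) with internal? w
  ...   | yes (c , pc) = inj₂ (c , trans (cong (_>>= up parent i) pc) e)
  ...   | no ¬internal with to (leaf-exact w) ¬internal
  ...     | x , refl = inj₁ (x , i , e)

  leaf-below : ∀ v → ∃[ x ] (v ⊑ leaf x)
  leaf-below v with descend n v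
  ... | inj₁ found = found
  ... | inj₂ (_ , e) = ⊥-elim (<-irrefl refl (up-length-bound e))

  -- if u were strictly below v, a sibling of the child of v towards u would
  -- carry a leaf below v but not below u
  ⊑-from-clusters : ∀ {u v} → (∀ x → v ⊑ leaf x → u ⊑ leaf x) → u ⊑ v
  ⊑-from-clusters {u} {v} cluster⊆ with leaf-below v
  ... | x , v⊑x with ⊑-total-below (cluster⊆ x v⊑x) v⊑x
  ...   | inj₁ u⊑v = u⊑v
  ...   | inj₂ v⊑u with ⊑-child-cases v⊑u
  ...     | inj₁ refl = ⊑-refl
  ...     | inj₂ (c , pc , c⊑u) with another-child pc
  ...       | d , pd , d≢c with leaf-below d
  ...         | y , d⊑y = ⊥-elim (d≢c (siblings-below pd pc d⊑y
                            (⊑-trans c⊑u (cluster⊆ y (⊑-trans (parent-⊑ pd) d⊑y)))))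

  IsMeet : Fin n → Fin n → Fin n → Set
  IsMeet a u v = a ⊑ u × a ⊑ v × (∀ w → w ⊑ u → w ⊑ v → w ⊑ a)

  meet-sym : ∀ {a u v} → IsMeet a u v → IsMeet a v u
  meet-sym (a⊑u , a⊑v , greatest) = a⊑v , a⊑u , λ w w⊑v w⊑u → greatest w w⊑u w⊑v

  meet-unique : ∀ {a b u v} → IsMeet a u v → IsMeet b u v → a ≡ b
  meet-unique (a⊑u , a⊑v , a-greatest) (b⊑u , b⊑v , b-greatest) =
    ⊑-antisym (b-greatest _ a⊑u a⊑v) (a-greatest _ b⊑u b⊑v)

  meet-at-depth : ∀ K {u} → up parent K u ≡ just root → ∀ v → ∃[ a ] IsMeet a u v
  meet-at-depth K {u} r v with u ⊑? v
  ... | yes u⊑v = u , ⊑-refl , u⊑v , λ _ w⊑u _ → w⊑u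
  meet-at-depth zero r v | no u⋢v =
    ⊥-elim (u⋢v (subst (_⊑ v) (sym (just-injective r)) (root-⊑ v)))
  meet-at-depth (suc K) r v | no u⋢v with up-suc-inv K r
  ... | p , pu , r' with meet-at-depth K r' v
  ...   | a , a⊑p , a⊑v , greatest = a , ⊑-trans a⊑p (parent-⊑ pu) , a⊑v , greatest'
    where
    greatest' : ∀ w → w ⊑ _ → w ⊑ v → w ⊑ a
    greatest' w w⊑u w⊑v with ⊑-parent-cases w⊑u pu
    ... | inj₁ refl = ⊥-elim (u⋢v w⊑v)
    ... | inj₂ w⊑p = greatest w w⊑p w⊑v

  meet : ∀ u v → ∃[ a ] IsMeet a u v
  meet u v = meet-at-depth (proj₁ (reachRoot u)) (proj₂ (reachRoot u)) v

  lca : ∀ x y → ∃[ a ] IsLCA T a x y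
  lca x y = meet (leaf x) (leaf y)

  meets-coincide : ∀ {u v w a b c} → IsMeet a u v → IsMeet b u w → IsMeet c v w →
    b ≡ c ⊎ a ≡ b ⊎ a ≡ c
  meets-coincide (a⊑u , a⊑v , a-greatest) (b⊑u , b⊑w , b-greatest) (c⊑v , c⊑w , c-greatest)
    with ⊑-total-below a⊑u b⊑u
  ... | inj₁ a⊑b with ⊑-total-below b⊑w c⊑w
  ...   | inj₁ b⊑c = inj₂ (inj₁ (⊑-antisym a⊑b (a-greatest _ b⊑u (⊑-trans b⊑c c⊑v))))
  ...   | inj₂ c⊑b = inj₂ (inj₂ (⊑-antisym (c-greatest _ a⊑v (⊑-trans a⊑b b⊑w))
                                           (a-greatest _ (⊑-trans c⊑b b⊑u) c⊑v)))
  meets-coincide (a⊑u , a⊑v , _) (b⊑u , b⊑w , b-greatest) (c⊑v , c⊑w , c-greatest)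
    | inj₂ b⊑a with ⊑-total-below c⊑v a⊑v
  ...   | inj₁ c⊑a = inj₁ (⊑-antisym (c-greatest _ (⊑-trans b⊑a a⊑v) b⊑w)
                                     (b-greatest _ (⊑-trans c⊑a a⊑u) c⊑w))
  ...   | inj₂ a⊑c = inj₂ (inj₁ (⊑-antisym (b-greatest _ a⊑u (⊑-trans a⊑c c⊑w)) b⊑a))

  internal-is-lca : ∀ {v} → Internal T v → ∃[ x ] ∃[ y ] (x ≢ y × IsLCA T v x y)
  internal-is-lca {v} iv with branching v iv
  ... | c₁ , c₂ , c₁≢c₂ , p₁ , p₂ with leaf-below c₁ | leaf-below c₂
  ...   | x , c₁⊑x | y , c₂⊑y =
    x , y , x≢y , ⊑-trans (parent-⊑ p₁) c₁⊑x , ⊑-trans (parent-⊑ p₂) c₂⊑y , greatest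
    where
    x≢y : x ≢ y
    x≢y refl = c₁≢c₂ (siblings-below p₁ p₂ c₁⊑x c₂⊑y)
    greatest : ∀ w → w ⊑ leaf x → w ⊑ leaf y → w ⊑ v
    greatest w w⊑x w⊑y with ⊑-total-below w⊑x (⊑-trans (parent-⊑ p₁) c₁⊑x)
    ... | inj₁ w⊑v = w⊑v
    ... | inj₂ v⊑w with ⊑-child-cases v⊑w
    ...   | inj₁ refl = ⊑-refl
    ...   | inj₂ (c , pc , c⊑w) = ⊥-elim (c₁≢c₂ (trans (sym c≡c₁) c≡c₂))
      where
      c≡c₁ = siblings-below pc p₁ (⊑-trans c⊑w w⊑x) c₁⊑x
      c≡c₂ = siblings-below pc p₂ (⊑-trans c⊑w w⊑y) c₂⊑y

  Displays⇒⋢ : ∀ {x y z c} → IsLCA T c x y → Displays T x y z → ¬ (c ⊑ leaf z)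
  Displays⇒⋢ lc (a , _ , c' , (a⊑x , a⊑z , a-greatest) , (a⊑y , _) , lc' , refl , a≢c') c⊑z
    with meet-unique lc' lc
  ... | refl = a≢c' (⊑-antisym (c-greatest _ a⊑x a⊑y) (a-greatest _ c⊑x c⊑z))
    where
    c⊑x = proj₁ lc
    c-greatest = proj₂ (proj₂ lc)

  meet-⊑-of-⋢ : ∀ {a c u v w} → IsMeet c u v → ¬ (c ⊑ w) → IsMeet a u w → a ⊑ c
  meet-⊑-of-⋢ (c⊑u , _) c⋢w (a⊑u , a⊑w , _) with ⊑-total-below a⊑u c⊑u
  ... | inj₁ a⊑c = a⊑c
  ... | inj₂ c⊑a = ⊥-elim (c⋢w (⊑-trans c⊑a a⊑w))

  ⋢⇒Displays : ∀ {x y z c} → IsLCA T c x y → ¬ (c ⊑ leaf z) → Displays T x y z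
  ⋢⇒Displays {x} {y} {z} {c} lc c⋢z with lca x z | lca y z
  ... | a , la | b , lb =
    a , b , c , la , lb , lc , ⊑-antisym a⊑b b⊑a , λ { refl → c⋢z (proj₁ (proj₂ la)) }
    where
    a⊑c = meet-⊑-of-⋢ lc c⋢z la
    b⊑c = meet-⊑-of-⋢ (meet-sym lc) c⋢z lb
    a⊑b = proj₂ (proj₂ lb) a (⊑-trans a⊑c (proj₁ (proj₂ lc))) (proj₁ (proj₂ la))
    b⊑a = proj₂ (proj₂ la) b (⊑-trans b⊑c (proj₁ lc)) (proj₁ (proj₂ lb))

  lca-⊑-leaf⇔¬Displays : ∀ {x y z c} → IsLCA T c x y → c ⊑ leaf z ⇔ (¬ Displays T x y z)
  lca-⊑-leaf⇔¬Displays {z = z} {c} lc = mk⇔ (λ c⊑z d → Displays⇒⋢ lc d c⊑z) ¬Displays⇒⊑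
    where
    ¬Displays⇒⊑ : ¬ Displays T _ _ z → c ⊑ leaf z
    ¬Displays⇒⊑ ¬d with c ⊑? leaf z
    ... | yes c⊑z = c⊑z
    ... | no c⋢z = contradiction (⋢⇒Displays lc c⋢z) ¬d

  infix 4 _⋖_
  _⋖_ : Fin n → Fin n → Set
  p ⋖ c = p ⊑ c × p ≢ c × (∀ w → w ⊑ c → w ≢ c → w ⊑ p)

  ⊑-parent : ∀ {w c p} → w ⊑ c → w ≢ c → parent c ≡ just p → w ⊑ p
  ⊑-parent w⊑c w≢c pc with ⊑-parent-cases w⊑c pc
  ... | inj₁ w≡c = contradiction w≡c w≢c
  ... | inj₂ w⊑p = w⊑p

  parent⇔⋖ : ∀ {c p} → parent c ≡ just p ⇔ p ⋖ c
  parent⇔⋖ {c} {p} = mk⇔ parent⇒⋖ ⋖⇒parent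
    where
    parent⇒⋖ : parent c ≡ just p → p ⋖ c
    parent⇒⋖ pc =
      parent-⊑ pc , (λ { refl → no-self-parent pc }) , λ w w⊑c w≢c → ⊑-parent w⊑c w≢c pc
    ⋖⇒parent : p ⋖ c → parent c ≡ just p
    ⋖⇒parent (p⊑c , p≢c , below) with parent c in pc
    ... | nothing = ⊥-elim (p≢c (trans (⊑-antisym p⊑c' (root-⊑ p)) (sym c≡root)))
      where
      c≡root = noParent⇒root c pc
      p⊑c' = subst (p ⊑_) c≡root p⊑c
    ... | just q = cong just (⊑-antisym (below q (parent-⊑ pc) (λ { refl → no-self-parent pc }))
                                        (⊑-parent p⊑c p≢c pc))

module _ {m : ℕ} {M : Set} (T T' : LabelledRootedTree m M) where
  private
    module A = RootedTree T
    module B = RootedTree T'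

  SameCluster : Fin A.n → Fin B.n → Set
  SameCluster v v' = ∀ x → v A.⊑ A.leaf x ⇔ v' B.⊑ B.leaf x

  SameCluster-⊑ : ∀ {u u' v v'} → SameCluster u u' → SameCluster v v' → u A.⊑ v ⇔ u' B.⊑ v'
  SameCluster-⊑ cu cv = mk⇔
    (λ u⊑v → B.⊑-from-clusters λ x v'⊑x → to (cu x) (A.⊑-trans u⊑v (from (cv x) v'⊑x)))
    (λ u'⊑v' → A.⊑-from-clusters λ x v⊑x → from (cu x) (B.⊑-trans u'⊑v' (to (cv x) v⊑x)))

  SameCluster-≡ : ∀ {u u' v v'} → SameCluster u u' → SameCluster v v' → u ≡ v ⇔ u' ≡ v'
  SameCluster-≡ cu cv = mk⇔
    (λ { refl → B.⊑-antisym (to (SameCluster-⊑ cu cv) A.⊑-refl)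
                            (to (SameCluster-⊑ cv cu) A.⊑-refl) })
    (λ { refl → A.⊑-antisym (from (SameCluster-⊑ cu cv) B.⊑-refl)
                            (from (SameCluster-⊑ cv cu) B.⊑-refl) })

  root-SameCluster : SameCluster A.root B.root
  root-SameCluster x = mk⇔ (λ _ → B.root-⊑ _) (λ _ → A.root-⊑ _)

  leaf-SameCluster : ∀ x → SameCluster (A.leaf x) (B.leaf x)
  leaf-SameCluster x z = mk⇔
    (λ x⊑z → subst (λ y → B.leaf x B.⊑ B.leaf y) (A.leaf-⊑-leaf x⊑z) B.⊑-refl)
    (λ x⊑z → subst (λ y → A.leaf x A.⊑ A.leaf y) (B.leaf-⊑-leaf x⊑z) A.⊑-refl)

  SameTriplets⇒SameCluster : SameTriplets T T' → ∀ v → ∃[ v' ] SameCluster v v'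
  SameTriplets⇒SameCluster st v with A.internal? v
  ... | no ¬internal with to (A.leaf-exact v) ¬internal
  ...   | x , refl = B.leaf x , leaf-SameCluster x
  SameTriplets⇒SameCluster st v | yes internal with A.internal-is-lca internal
  ... | x , y , x≢y , lc with B.lca x y
  ...   | c' , lc' = c' , same
    where
    same : SameCluster v c'
    same z with z ≟ x | z ≟ y
    ... | yes refl | _       = mk⇔ (λ _ → proj₁ lc') (λ _ → proj₁ lc)
    ... | no _     | yes refl = mk⇔ (λ _ → proj₁ (proj₂ lc')) (λ _ → proj₁ (proj₂ lc))
    ... | no z≢x   | no z≢y  =
      ⇔-trans (A.lca-⊑-leaf⇔¬Displays lc)
        (⇔-trans (¬-cong-⇔ (st x y z (x≢y , ≢-sym z≢x , ≢-sym z≢y)))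
          (⇔-sym (B.lca-⊑-leaf⇔¬Displays lc')))

  module _ (counterpart : ∀ v' → ∃[ v ] SameCluster v v') where

    SameCluster-lca : ∀ {a a' x y} → SameCluster a a' → IsLCA T a x y → IsLCA T' a' x y
    SameCluster-lca {x = x} {y} ca (a⊑x , a⊑y , greatest) = to (ca x) a⊑x , to (ca y) a⊑y , greatest'
      where
      greatest' : ∀ w' → w' B.⊑ B.leaf x → w' B.⊑ B.leaf y → w' B.⊑ _
      greatest' w' w'⊑x w'⊑y with counterpart w'
      ... | w , cw = to (SameCluster-⊑ cw ca) (greatest w (from (cw x) w'⊑x) (from (cw y) w'⊑y))

    SameCluster-⋖ : ∀ {p p' c c'} → SameCluster p p' → SameCluster c c' → p A.⋖ c → p' B.⋖ c'
    SameCluster-⋖ cp cc (p⊑c , p≢c , below) =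
      to (SameCluster-⊑ cp cc) p⊑c , p≢c ∘ from (SameCluster-≡ cp cc) , below'
      where
      below' : ∀ w' → w' B.⊑ _ → w' ≢ _ → w' B.⊑ _
      below' w' w'⊑c' w'≢c' with counterpart w'
      ... | w , cw = to (SameCluster-⊑ cw cp)
                        (below w (from (SameCluster-⊑ cw cc) w'⊑c') (w'≢c' ∘ to (SameCluster-≡ cw cc)))

SameCluster-sym : ∀ {m M} {T T' : LabelledRootedTree m M} {v v'} →
  SameCluster T T' v v' → SameCluster T' T v' v
SameCluster-sym c x = ⇔-sym (c x)

avoid-two : ∀ {m} → m ≥ 3 → (x y : Fin m) → ∃[ z ] (z ≢ x × z ≢ y)
avoid-two (s≤s (s≤s (s≤s _))) (fsuc x)         (fsuc y)         = fzero , (λ ()) , (λ ())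
avoid-two (s≤s (s≤s (s≤s _))) fzero            fzero            = fsuc fzero , (λ ()) , (λ ())
avoid-two (s≤s (s≤s (s≤s _))) fzero            (fsuc fzero)     = fsuc (fsuc fzero) , (λ ()) , (λ ())
avoid-two (s≤s (s≤s (s≤s _))) fzero            (fsuc (fsuc y))  = fsuc fzero , (λ ()) , (λ ())
avoid-two (s≤s (s≤s (s≤s _))) (fsuc fzero)     fzero            = fsuc (fsuc fzero) , (λ ()) , (λ ())
avoid-two (s≤s (s≤s (s≤s _))) (fsuc (fsuc x))  fzero            = fsuc fzero , (λ ()) , (λ ())

module Matching {m : ℕ} {M : Set} (T T' : LabelledRootedTree m M) (sameTriplets : SameTriplets T T') where
  private
    module A = RootedTree T
    module B = RootedTree T'

  φ : Fin A.n → Fin B.n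
  φ v = proj₁ (SameTriplets⇒SameCluster T T' sameTriplets v)

  φ-cluster : ∀ v → SameCluster T T' v (φ v)
  φ-cluster v = proj₂ (SameTriplets⇒SameCluster T T' sameTriplets v)

  counterpart : ∀ v' → ∃[ v ] SameCluster T T' v v'
  counterpart v' with SameTriplets⇒SameCluster T' T (λ x y z d → ⇔-sym (sameTriplets x y z d)) v'
  ... | v , c = v , SameCluster-sym {T = T'} {T} c

  ψ : Fin B.n → Fin A.n
  ψ v' = proj₁ (counterpart v')

  φ∘ψ : ∀ v' → φ (ψ v') ≡ v'
  φ∘ψ v' = to (SameCluster-≡ T T' (φ-cluster (ψ v')) (proj₂ (counterpart v'))) refl

  ψ∘φ : ∀ v → ψ (φ v) ≡ v
  ψ∘φ v = from (SameCluster-≡ T T' (proj₂ (counterpart (φ v))) (φ-cluster v)) refl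

  φ-↔ : Fin A.n ↔ Fin B.n
  φ-↔ = mk↔ₛ′ φ ψ φ∘ψ ψ∘φ

  φ-root : φ A.root ≡ B.root
  φ-root = to (SameCluster-≡ T T' (φ-cluster A.root) (root-SameCluster T T')) refl

  φ-leaf : ∀ x → B.leaf x ≡ φ (A.leaf x)
  φ-leaf x = to (SameCluster-≡ T T' (leaf-SameCluster T T' x) (φ-cluster (A.leaf x))) refl

  φ-parent : ∀ v → B.parent (φ v) ≡ map φ (A.parent v)
  φ-parent v with A.parent v in pv
  ... | just p = from B.parent⇔⋖
    (SameCluster-⋖ T T' counterpart (φ-cluster p) (φ-cluster v) (to A.parent⇔⋖ pv))
  ... | nothing rewrite A.noParent⇒root v pv | φ-root = B.root-noParent

  φ-label : m ≥ 3 → SameDelta T T' → ∀ v → Internal T v → B.label (φ v) ≡ A.label v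
  φ-label m≥3 sameδ v internal with A.internal-is-lca internal
  ... | x , y , x≢y , lv with avoid-two m≥3 x y
  ...   | z , z≢x , z≢y with A.lca x z | A.lca y z
  ...     | b , lb | c , lc = sym (↭-head-inv coincidence δ-equal)
    where
    φ-lca : ∀ {a x y} → IsLCA T a x y → IsLCA T' (φ a) x y
    φ-lca = SameCluster-lca T T' counterpart (φ-cluster _)
    both : ∀ {u w} → u ≡ w → A.label u ≡ A.label w × B.label (φ u) ≡ B.label (φ w)
    both e = cong A.label e , cong (B.label ∘ φ) e
    coincidence = Sum.map both (Sum.map both both) (A.meets-coincide lv lb lc)
    δ-equal = sameδ x y z (x≢y , ≢-sym z≢x , ≢-sym z≢y) v b c (φ v) (φ b) (φ c)
                    lv lb lc (φ-lca lv) (φ-lca lb) (φ-lca lc)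

corollary13 : (m : ℕ) → m ≥ 3 → (M : Set) → (T T' : LabelledRootedTree m M) →
    SameDelta T T' → SameTriplets T T' → Isomorphic T T'
corollary13 m m≥3 M T T' sameδ sameTriplets =
  φ-↔ , φ-root , φ-parent , φ-leaf , φ-label m≥3 sameδ
  where open Matching T T' sameTriplets
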